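{- Let $\mathcal{B}_{b,t}$ be a blossom and let $v\in\mathcal{B}_{b,t}$. Then there exists $k$ with $1\le k\le N(\mathcal{B}_{b,t})$ such that $b=\mathrm{base}^k(v)$. Furthermore, all the vertices $\mathrm{base}(v),\ldots,\mathrm{base}^{k-1}(v)$ belong to $\mathcal{B}_{b,t}$.
   Context: $G=(V,E)$ is a finite undirected graph with a matching $M$, with at least one unmatched vertex. Alternating paths are simple paths alternating between unmatched edges (not in $M$) and matched edges (in $M$), starting with an unmatched edge when starting at an unmatched vertex. $l_m$ is the minimum length of an augmenting path (alternating path between two distinct unmatched vertices), $\infty$ if none. $\mathrm{evenlevel}(v)$, $\mathrm{oddlevel}(v)$ are the minimum lengths of even, resp. odd, alternating paths from an unmatched vertex to $v$ ($\infty$ if none); such minimum paths are $\mathrm{evenlevel}(v)$, $\mathrm{oddlevel}(v)$ paths. Tenacity $t(v)=\mathrm{evenlevel}(v)+\mathrm{oddlevel}(v)$. A vertex is outer if $\mathrm{evenlevel}(v)<\mathrm{oddlevel}(v)$. For $t(v)=t<l_m$, $\mathrm{base}(v)$ is the vertex of tenacity $>t$ furthest from the starting unmatched vertex $f$ along any $\mathrm{evenlevel}(v)$ or $\mathrm{oddlevel}(v)$ path $p$ (it is known to be independent of $p$). Iterated bases: $\mathrm{base}^0(v)=v$, $\mathrm{base}^1(v)=\mathrm{base}(v)$, and $\mathrm{base}^{k+1}(v)=\mathrm{base}(\mathrm{base}^k(v))$ whenever $t(\mathrm{base}^k(v))<l_m$. Blossoms: for an outer vertex $b$ and an odd number $t$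 with $t<t(b)$ and $t<l_m$, define $\mathcal{B}_{b,1}=\emptyset$ with nesting depth $N(\mathcal{B}_{b,1})=0$; for $t\ge3$ let $S_{b,t}=\{v: t(v)=t,\ \mathrm{base}(v)=b\}$ and $\mathcal{B}_{b,t}=S_{b,t}\cup\bigcup_{v\in S_{b,t}\cup\{b\},\ v\text{ outer}}\mathcal{B}_{v,t-2}$, with nesting depth $N(\mathcal{B}_{b,t})=1+\max_{v\in S_{b,t}\cup\{b\},\ v\text{ outer}}N(\mathcal{B}_{v,t-2})$ if $S_{b,t}\neq\emptyset$, and $N(\mathcal{B}_{b,t})=N(\mathcal{B}_{b,t-2})$ otherwise. -}

module Defs where

open import Data.Nat using (ℕ; zero; suc; _+_; _*_; _<_; _≤_; _⊔_; _%_; _≡ᵇ_; _<ᵇ_)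
open import Data.Fin using (Fin; toℕ)
open import Data.Fin.Properties using () renaming (_≟_ to _≟ᶠ_)
open import Data.Bool using (Bool; true; false; not; _∧_; if_then_else_)
open import Data.List using (List; []; _∷_; length; lookup; allFin; filterᵇ; null; map; foldr)
open import Data.List.Relation.Unary.Unique.Propositional using (Unique)
open import Data.Product using (Σ; _×_; _,_; ∃; ∃-syntax)
open import Data.Sum using (_⊎_)
open import Data.Empty using (⊥)
open import Data.Unit using (⊤)
open import Relation.Nullary using (¬_; does)
open import Relation.Binary.PropositionalEquality using (_≡_; _≢_)

data ℕ∞ : Set where
  fin : ℕ → ℕ∞
  ∞   : ℕ∞

_+∞_ : ℕ∞ → ℕ∞ → ℕ∞
fin a +∞ fin b = fin (a + b)
fin a +∞ ∞     = ∞
∞     +∞ _     = ∞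

_<∞_ : ℕ∞ → ℕ∞ → Set
fin a <∞ fin b = a < b
fin a <∞ ∞     = ⊤
∞     <∞ _     = ⊥

_<∞ᵇ_ : ℕ∞ → ℕ∞ → Bool
fin a <∞ᵇ fin b = a <ᵇ b
fin a <∞ᵇ ∞     = true
∞     <∞ᵇ _     = false

_≡∞ᵇ_ : ℕ∞ → ℕ∞ → Bool
fin a ≡∞ᵇ fin b = a ≡ᵇ b
∞     ≡∞ᵇ ∞     = true
_     ≡∞ᵇ _     = false

IsMin : (ℕ → Set) → ℕ∞ → Set
IsMin P (fin k) = P k × (∀ j → P j → k ≤ j)
IsMin P ∞       = ∀ j → ¬ P j

Even Odd : ℕ → Set
Even k = k % 2 ≡ 0
Odd  k = k % 2 ≡ 1

module _ {n : ℕ} (E M : Fin n → Fin n → Set) where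

  Unmatched : Fin n → Set
  Unmatched x = ∀ y → ¬ M x y

  EdgeIs : Bool → Fin n → Fin n → Set
  EdgeIs true  x y = M x y
  EdgeIs false x y = ¬ M x y

  AltSteps : Bool → Fin n → List (Fin n) → Set
  AltSteps s x []       = ⊤
  AltSteps s x (y ∷ ys) = E x y × EdgeIs s x y × AltSteps (not s) y ys

  endV : Fin n → List (Fin n) → Fin n
  endV x []       = x
  endV x (y ∷ ys) = endV y ys

  -- The path f ∷ p (of length = length p) is a simple alternating path
  -- from the unmatched vertex f to v, starting with an unmatched edge.
  AltPath : Fin n → List (Fin n) → Fin n → Set
  AltPath f p v = Unmatched f × Unique (f ∷ p) × AltSteps false f p × endV f p ≡ v

  EvenReach OddReach : Fin n → ℕ → Set
  EvenReach v k = Even k × ∃[ f ] ∃[ p ] (AltPath f p v × length p ≡ k)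
  OddReach  v k = Odd  k × ∃[ f ] ∃[ p ] (AltPath f p v × length p ≡ k)

  AugReach : ℕ → Set
  AugReach k = ∃[ f ] ∃[ p ] ∃[ g ] (AltPath f p g × Unmatched g × f ≢ g × length p ≡ k)

record Setting (n : ℕ) : Set₁ where
  field
    E        : Fin n → Fin n → Set
    E-sym    : ∀ x y → E x y → E y x
    E-irrefl : ∀ x → ¬ E x x
    M        : Fin n → Fin n → Set
    M⊆E      : ∀ x y → M x y → E x y
    M-sym    : ∀ x y → M x y → M y x
    M-match  : ∀ x y z → M x y → M x z → y ≡ z
    unmatched-exists : ∃[ f ] Unmatched E M f

    evenlevel : Fin n → ℕ∞
    evenlevel-spec : ∀ v → IsMin (EvenReach E M v) (evenlevel v)
    oddlevel  : Fin n → ℕ∞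
    oddlevel-spec  : ∀ v → IsMin (OddReach E M v) (oddlevel v)
    lm : ℕ∞
    lm-spec : IsMin (AugReach E M) lm

  ten : Fin n → ℕ∞
  ten v = evenlevel v +∞ oddlevel v

  Outer : Fin n → Set
  Outer v = evenlevel v <∞ oddlevel v

  MinPath : Fin n → List (Fin n) → Fin n → Set
  MinPath f p v = AltPath E M f p v × (fin (length p) ≡ evenlevel v ⊎ fin (length p) ≡ oddlevel v)

  FurthestHigh : ℕ → Fin n → List (Fin n) → Fin n → Set
  FurthestHigh t f p b =
    Σ (Fin (length (f ∷ p))) λ i →
      lookup (f ∷ p) i ≡ b × fin t <∞ ten b ×
      (∀ (j : Fin (length (f ∷ p))) → toℕ i < toℕ j → ¬ (fin t <∞ ten (lookup (f ∷ p) j)))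

  field
    base : Fin n → Fin n
    base-spec : ∀ v t → ten v ≡ fin t → fin t <∞ lm →
                ∀ f p → MinPath f p v → FurthestHigh t f p (base v)

module Blossoms {n : ℕ} (G : Setting n) where
  open Setting G

  baseIter : ℕ → Fin n → Fin n
  baseIter zero    v = v
  baseIter (suc k) v = base (baseIter k v)

  InS : Fin n → ℕ → Fin n → Set
  InS b t v = ten v ≡ fin t × base v ≡ b

  -- x ∈ 𝓑_{b,t}   (𝓑_{b,1} = ∅; the cases t = 0 and even t are never used)
  InB : Fin n → ℕ → Fin n → Set
  InB b zero          x = ⊥
  InB b (suc zero)    x = ⊥
  InB b (suc (suc t)) x =
    InS b (suc (suc t)) x ⊎
    (∃[ u ] ((InS b (suc (suc t)) u ⊎ u ≡ b) × Outer u × InB u t x))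

  inSᵇ : Fin n → ℕ → Fin n → Bool
  inSᵇ b t v = (ten v ≡∞ᵇ fin t) ∧ does (base v ≟ᶠ b)

  outerᵇ : Fin n → Bool
  outerᵇ v = evenlevel v <∞ᵇ oddlevel v

  maxList : List ℕ → ℕ
  maxList = foldr _⊔_ 0

  N : Fin n → ℕ → ℕ
  N b zero          = 0
  N b (suc zero)    = 0
  N b (suc (suc t)) =
    let S = filterᵇ (inSᵇ b (suc (suc t))) (allFin n) in
    if null S
      then N b t
      else suc (maxList (map (λ u → N u t) (filterᵇ outerᵇ (b ∷ S))))

-- Induction on t along the recursive definition of 𝓑_{b,t}. A vertex of S_{b,t} reaches b
-- in one base step. A vertex of an inner blossom 𝓑_{u,t-2} reaches u by induction; if u = b
-- that chain already works, and if base(u) = b it is extended by one step. In the latter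
-- case S_{b,t} ≠ ∅, so N(𝓑_{b,t}) ≥ 1 + N(𝓑_{u,t-2}) pays for the extra step.
module Submission where

open import Defs
open import Data.Nat using (ℕ; zero; suc; _<_; _≤_; _⊔_; s≤s; z≤n)
open import Data.Nat.Properties
  using (<⇒<ᵇ; ≡⇒≡ᵇ; <-≤-trans; ≤-refl; ≤-trans; m≤m⊔n; m≤n⊔m; n≤1+n; m≤n+m; m<1+n⇒m<n∨m≡n)
open import Data.Fin using (Fin)
open import Data.Fin.Properties using () renaming (_≟_ to _≟ᶠ_)
open import Data.Bool using (Bool; true; false; T)
open import Data.Bool.Properties using (T-∧; T-≡)
open import Data.List using (List; _∷_; foldr; filterᵇ; null; map; allFin)
open import Data.List.Membership.Propositional using (_∈_)
open import Data.List.Membership.Propositional.Properties using (∈-allFin; ∈-map⁺; ∈-filter⁺)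
open import Data.List.Relation.Unary.Any using (here; there)
open import Data.Product using (_×_; _,_; ∃-syntax)
open import Data.Sum using (_⊎_; inj₁; inj₂)
open import Data.Unit using (tt)
open import Function using (_∘_; Equivalence)
open import Relation.Nullary.Decidable using (T?; dec-true)
open import Relation.Binary.PropositionalEquality using (_≡_; refl; sym; trans; cong; subst)

<∞⇒<∞ᵇ : ∀ {x y} → x <∞ y → T (x <∞ᵇ y)
<∞⇒<∞ᵇ {fin a} {fin b} a<b = <⇒<ᵇ a<b
<∞⇒<∞ᵇ {fin a} {∞}     _   = tt

≡⇒≡∞ᵇ : ∀ {x y} → x ≡ fin y → T (x ≡∞ᵇ fin y)
≡⇒≡∞ᵇ {y = y} refl = ≡⇒≡ᵇ y y refl

<∞-weakenˡ : ∀ {m k x} → m ≤ k → fin k <∞ x → fin m <∞ x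
<∞-weakenˡ {x = fin a} m≤k k<a = <-≤-trans (s≤s m≤k) k<a
<∞-weakenˡ {x = ∞}     _   _   = tt

∈⇒≤foldr⊔ : ∀ {x xs} → x ∈ xs → x ≤ foldr _⊔_ 0 xs
∈⇒≤foldr⊔ {xs = y ∷ ys} (here refl) = m≤m⊔n y (foldr _⊔_ 0 ys)
∈⇒≤foldr⊔ {xs = y ∷ ys} (there x∈ys) = ≤-trans (∈⇒≤foldr⊔ x∈ys) (m≤n⊔m y (foldr _⊔_ 0 ys))

∈⇒null≡false : ∀ {A : Set} {x : A} {xs} → x ∈ xs → null xs ≡ false
∈⇒null≡false (here _)  = refl
∈⇒null≡false (there _) = refl

∈-filterᵇ⁺ : ∀ {A : Set} (p : A → Bool) {x xs} → x ∈ xs → T (p x) → x ∈ filterᵇ p xs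
∈-filterᵇ⁺ p = ∈-filter⁺ (T? ∘ p)

<-suc-extend : ∀ {P : ℕ → Set} {k} → (∀ j → j < k → P j) → P k → ∀ j → j < suc k → P j
<-suc-extend below at-k j j<1+k with m<1+n⇒m<n∨m≡n j<1+k
... | inj₁ j<k  = below j j<k
... | inj₂ refl = at-k

module _ {n : ℕ} (G : Setting n) where
  open Setting G
  open Blossoms G

  S : Fin n → ℕ → List (Fin n)
  S b t = filterᵇ (inSᵇ b t) (allFin n)

  InS⇒∈S : ∀ {b t v} → InS b t v → v ∈ S b t
  InS⇒∈S {b} {t} {v} (tv≡t , base-v≡b) =
    ∈-filterᵇ⁺ (inSᵇ b t) (∈-allFin v)
      (Equivalence.from T-∧ (≡⇒≡∞ᵇ tv≡t , Equivalence.from T-≡ (dec-true (base v ≟ᶠ b) base-v≡b)))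

  InS⊎≡⇒∈ : ∀ {b t u} → InS b t u ⊎ u ≡ b → u ∈ b ∷ S b t
  InS⊎≡⇒∈ (inj₁ u∈S) = there (InS⇒∈S u∈S)
  InS⊎≡⇒∈ (inj₂ refl) = here refl

  N≤maxList : ∀ {b t u} → Outer u → InS b (suc (suc t)) u ⊎ u ≡ b →
              N u t ≤ maxList (map (λ w → N w t) (filterᵇ outerᵇ (b ∷ S b (suc (suc t)))))
  N≤maxList {t = t} outer-u u∈ =
    ∈⇒≤foldr⊔ (∈-map⁺ (λ w → N w t) (∈-filterᵇ⁺ outerᵇ (InS⊎≡⇒∈ u∈) (<∞⇒<∞ᵇ outer-u)))

  N-inner< : ∀ {b t u v} → InS b (suc (suc t)) v → Outer u → InS b (suc (suc t)) u ⊎ u ≡ b →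
             N u t < N b (suc (suc t))
  N-inner< v∈S outer-u u∈ rewrite ∈⇒null≡false (InS⇒∈S v∈S) = s≤s (N≤maxList outer-u u∈)

  N-mono : ∀ {b} t → Outer b → N b t ≤ N b (suc (suc t))
  N-mono {b} t outer-b with null (S b (suc (suc t)))
  ... | true  = ≤-refl
  ... | false = ≤-trans (N≤maxList outer-b (inj₂ refl)) (n≤1+n _)

  BaseChain : Fin n → ℕ → Fin n → Set
  BaseChain b t v = ∃[ k ] (1 ≤ k × k ≤ N b t × baseIter k v ≡ b ×
                      (∀ j → j < k → ten (baseIter j v) <∞ lm) ×
                      (∀ j → 1 ≤ j → j < k → InB b t (baseIter j v)))

  chain-direct : ∀ {b t v} → Outer b → fin (suc (suc t)) <∞ lm → InS b (suc (suc t)) v →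
                 BaseChain b (suc (suc t)) v
  chain-direct outer-b t<lm v∈S@(tv≡t , base-v≡b) =
    1 , ≤-refl , ≤-trans (s≤s z≤n) (N-inner< v∈S outer-b (inj₂ refl)) , base-v≡b ,
    (λ { zero _ → subst (_<∞ lm) (sym tv≡t) t<lm ; (suc _) (s≤s ()) }) ,
    (λ { zero () _ ; (suc _) _ (s≤s ()) })

  chain-enlarge : ∀ {b t v} → Outer b → BaseChain b t v → BaseChain b (suc (suc t)) v
  chain-enlarge {t = t} outer-b (k , 1≤k , k≤N , reaches , below , inside) =
    k , 1≤k , ≤-trans k≤N (N-mono t outer-b) , reaches , below ,
    (λ j 1≤j j<k → inj₂ (_ , inj₂ refl , outer-b , inside j 1≤j j<k))

  chain-through : ∀ {b t u v} → InS b (suc (suc t)) u → Outer u → fin (suc (suc t)) <∞ lm →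
                  BaseChain u t v → BaseChain b (suc (suc t)) v
  chain-through {b} {t} {u} {v} u∈S@(tu≡t , base-u≡b) outer-u t<lm
                (k , 1≤k , k≤N , reaches , below , inside) =
    suc k , s≤s z≤n , ≤-trans (s≤s k≤N) (N-inner< u∈S outer-u (inj₁ u∈S)) ,
    trans (cong base reaches) base-u≡b ,
    <-suc-extend below (subst (λ w → ten w <∞ lm) (sym reaches) (subst (_<∞ lm) (sym tu≡t) t<lm)) ,
    (λ j 1≤j j<1+k → <-suc-extend {P = λ j → 1 ≤ j → InB b (suc (suc t)) (baseIter j v)}
       (λ j j<k 1≤j → inj₂ (u , inj₁ u∈S , outer-u , inside j 1≤j j<k))
       (λ _ → inj₁ (subst (InS b (suc (suc t))) (sym reaches) u∈S))
       j j<1+k 1≤j)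

  baseChain : ∀ b t → Outer b → fin t <∞ lm → ∀ v → InB b t v → BaseChain b t v
  baseChain b (suc (suc t)) outer-b t<lm v (inj₁ v∈S) = chain-direct outer-b t<lm v∈S
  baseChain b (suc (suc t)) outer-b t<lm v (inj₂ (u , u∈ , outer-u , v∈B))
    with u∈ | baseChain u t outer-u (<∞-weakenˡ (m≤n+m t 2) t<lm) v v∈B
  ... | inj₂ refl | inner = chain-enlarge outer-b inner
  ... | inj₁ u∈S  | inner = chain-through u∈S outer-u t<lm inner

lemma7 : ∀ {n : ℕ} (G : Setting n) (b : Fin n) (t : ℕ) →
         Setting.Outer G b → Odd t → fin t <∞ Setting.ten G b → fin t <∞ Setting.lm G →
         ∀ (v : Fin n) → Blossoms.InB G b t v →
         ∃[ k ] (1 ≤ k × k ≤ Blossoms.N G b t × Blossoms.baseIter G k v ≡ b ×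
                 (∀ j → j < k → Setting.ten G (Blossoms.baseIter G j v) <∞ Setting.lm G) ×
                 (∀ j → 1 ≤ j → j < k → Blossoms.InB G b t (Blossoms.baseIter G j v)))
lemma7 G b t outer-b _ _ t<lm = baseChain G b t outer-b t<lm
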